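{- Let $G$ be a finite, simple, connected graph on $n$ vertices. A signed graph $(G,\sigma)$ is a parity signed graph if and only if it can be obtained from $(G,+)$ by switching at a set of vertices of cardinality $\lfloor n/2\rfloor$.
   Context: A signed graph $(G,\sigma)$ is a graph $G$ with a map $\sigma:E(G)\to\{1,-1\}$; $(G,+)$ denotes the signed graph with all edges assigned $1$. Switching at a vertex $v$ replaces $\sigma(e)$ by $-\sigma(e)$ for every edge $e$ incident with $v$ and leaves other edges unchanged; switching at a set of vertices means switching at each of its vertices in turn. $(G,\sigma)$ is a parity signed graph if there is a bijection $f:V(G)\to\{1,\dots,n\}$ such that for every edge $uv$, $f(u),f(v)$ have the same parity if $\sigma(uv)=1$ and opposite parities if $\sigma(uv)=-1$. -}

module Defs where

open import Data.Nat using (ℕ; zero; suc)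
open import Data.Bool using (Bool; true; false; T; if_then_else_; not)
open import Data.Fin using (Fin; toℕ; _≟_)
open import Data.Fin.Subset using (Subset)
open import Data.List using (foldr; allFin)
open import Data.Vec using (lookup)
open import Relation.Nullary using (yes; no)
open import Relation.Binary.PropositionalEquality using (_≡_)

record SimpleGraph (n : ℕ) : Set where
  field
    adj   : Fin n → Fin n → Bool
    sym   : ∀ u v → adj u v ≡ adj v u
    irref : ∀ v → adj v v ≡ false
open SimpleGraph public

Adj : ∀ {n} → SimpleGraph n → Fin n → Fin n → Set
Adj G u v = T (adj G u v)

data Walk {n} (G : SimpleGraph n) : Fin n → Fin n → Set where
  here : ∀ {v} → Walk G v v
  step : ∀ {u w v} → Adj G u w → Walk G w v → Walk G u v

Connected : ∀ {n} → SimpleGraph n → Set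
Connected {n} G = ∀ (u v : Fin n) → Walk G u v

data Sign : Set where
  plus minus : Sign

neg : Sign → Sign
neg plus = minus
neg minus = plus

-- A signature σ : E(G) → {1,-1}.  Represented on ordered pairs, symmetric on
-- edges; values on non-adjacent pairs are never inspected (all notions below
-- only look at edges).
record Signature {n} (G : SimpleGraph n) : Set where
  field
    sign     : Fin n → Fin n → Sign
    sign-sym : ∀ u v → Adj G u v → sign u v ≡ sign v u
open Signature public

_≈E_ : ∀ {n} {G : SimpleGraph n} → Signature G → Signature G → Set
_≈E_ {n} {G} σ τ = ∀ (u v : Fin n) → Adj G u v → sign σ u v ≡ sign τ u v

allPlus : ∀ {n} (G : SimpleGraph n) → Signature G
allPlus G = record { sign = λ _ _ → plus ; sign-sym = λ _ _ _ → _≡_.refl }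

incident : ∀ {n} → Fin n → Fin n → Fin n → Bool
incident x u v with x ≟ u | x ≟ v
... | yes _ | _     = true
... | no _  | yes _ = true
... | no _  | no _  = false

switchAt : ∀ {n} → Fin n → (Fin n → Fin n → Sign) → (Fin n → Fin n → Sign)
switchAt x s u v = if incident x u v then neg (s u v) else s u v

switchSet : ∀ {n} → Subset n → (Fin n → Fin n → Sign) → (Fin n → Fin n → Sign)
switchSet {n} S s = foldr (λ x t → if lookup S x then switchAt x t else t) s (allFin n)

switchSet-sym : ∀ {n} (G : SimpleGraph n) (S : Subset n) (σ : Signature G) →
  ∀ u v → Adj G u v → switchSet S (sign σ) u v ≡ switchSet S (sign σ) v u
switchSet-sym {n} G S σ u v p = go (allFin n)
  where
    open import Relation.Binary.PropositionalEquality using (cong; refl)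
    open import Data.List using (List; []; _∷_)
    incident-sym : ∀ x → incident x u v ≡ incident x v u
    incident-sym x with x ≟ u | x ≟ v
    ... | yes _ | yes _ = refl
    ... | yes _ | no _  = refl
    ... | no _  | yes _ = refl
    ... | no _  | no _  = refl
    f : Fin n → (Fin n → Fin n → Sign) → (Fin n → Fin n → Sign)
    f x t = if lookup S x then switchAt x t else t
    go : ∀ xs → foldr f (sign σ) xs u v ≡ foldr f (sign σ) xs v u
    go [] = sign-sym σ u v p
    go (x ∷ xs) with lookup S x
    ... | false = go xs
    ... | true rewrite incident-sym x with incident x v u
    ...   | true  = cong neg (go xs)
    ...   | false = go xs

switching : ∀ {n} {G : SimpleGraph n} → Subset n → Signature G → Signature G
switching {G = G} S σ = record { sign = switchSet S (sign σ) ; sign-sym = switchSet-sym G S σ }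

isEven : ℕ → Bool
isEven zero    = true
isEven (suc k) = not (isEven k)

sameParity : ℕ → ℕ → Bool
sameParity a b with isEven a | isEven b
... | true  | true  = true
... | false | false = true
... | _     | _     = false

-- f labels vertices by {1,…,n}: vertex v gets label suc (toℕ (f v)).
-- (G,σ) is a parity signed graph w.r.t. the bijection f
ParityLabelling : ∀ {n} {G : SimpleGraph n} → Signature G → (Fin n → Fin n) → Set
ParityLabelling {n} {G} σ f =
  ∀ (u v : Fin n) → Adj G u v →
    sign σ u v ≡ (if sameParity (suc (toℕ (f u))) (suc (toℕ (f v))) then plus else minus)

-- Label the vertices by a bijection f onto {1,…,n}. An edge uv must then be
-- negative exactly when one endpoint has an even label and the other an odd
-- one, which is precisely the sign that switching (G,+) at the set of
-- even-labelled vertices produces on uv. There are ⌊n/2⌋ even labels, and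
-- conversely any set of size ⌊n/2⌋ can be made the even-labelled set of some
-- bijection, by a permutation matching its indicator to that of the even labels.

module Submission where

open import Defs
open import Algebra.Bundles using (CommutativeRing)
import Algebra.Properties.CommutativeMonoid.Sum as CommutativeMonoidSum
open import Data.Empty using (⊥-elim)
open import Data.Bool using (Bool; true; false; _∧_; _xor_; if_then_else_; T)
open import Data.Bool.Properties
  using (not-involutive; ∧-zeroʳ; ∧-identityʳ; ∧-distribˡ-xor; xor-identityʳ; xor-∧-commutativeRing)
open import Data.Fin using (Fin; zero; suc; toℕ; _≟_)
open import Data.Fin.Permutation using (Permutation′; _⟨$⟩ʳ_; lift₀; transpose; _∘ₚ_)
import Data.Fin.Permutation as Permutation
open import Data.Fin.Subset using (Subset; ∣_∣)
open import Data.List as List using (foldr)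
open import Data.Nat using (ℕ; zero; suc; _+_; _/_; _≤_; _<_; z≤n; s≤s; s≤s⁻¹; ⌊_/2⌋; ⌈_/2⌉)
open import Data.Nat.DivMod using (m/n≡1+[m∸n]/n)
open import Data.Nat.Properties using (+-0-commutativeMonoid; +-cancelˡ-≡; m≤n⇒m≤1+n)
open import Data.Product as Σ using (Σ; ∃-syntax; _×_; _,_)
open import Data.Vec using ([]; _∷_; lookup; tabulate)
open import Data.Vec.Properties using (lookup∘tabulate; tabulate∘lookup; tabulate-cong)
open import Function using (_∘_)
open import Function.Bundles using (_⇔_; mk⇔; mk⤖; Bijection; Equivalence)
open import Function.Definitions using (Bijective)
open import Function.Properties.Bijection using (⤖⇒↔)
open import Function.Properties.Inverse using (Inverse⇒Bijection)
open import Relation.Nullary using (yes; no; does)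
import Relation.Binary.PropositionalEquality as ≡
open import Relation.Binary.PropositionalEquality
  using (_≡_; _≢_; refl; trans; cong; cong₂; subst; module ≡-Reasoning)

module ℕ-Sum = CommutativeMonoidSum +-0-commutativeMonoid
module Xor-Sum = CommutativeMonoidSum (CommutativeRing.+-commutativeMonoid xor-∧-commutativeRing)

count : ∀ {n} → (Fin n → Bool) → ℕ
count P = ℕ-Sum.sum (λ i → if P i then 1 else 0)

count-cong : ∀ {n} {P Q : Fin n → Bool} → (∀ i → P i ≡ Q i) → count P ≡ count Q
count-cong P≗Q = ℕ-Sum.sum-cong-≗ (λ i → cong (λ b → if b then 1 else 0) (P≗Q i))

count-permute : ∀ {n} (P : Fin n → Bool) (π : Permutation′ n) → count (P ∘ (π ⟨$⟩ʳ_)) ≡ count P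
count-permute P π = ≡.sym (ℕ-Sum.sum-permute (λ i → if P i then 1 else 0) π)

count≤n : ∀ {n} (P : Fin n → Bool) → count P ≤ n
count≤n {zero}  P = z≤n
count≤n {suc n} P with P zero
... | true  = s≤s (count≤n (P ∘ suc))
... | false = m≤n⇒m≤1+n (count≤n (P ∘ suc))

∣p∣≡count : ∀ {n} (p : Subset n) → ∣ p ∣ ≡ count (lookup p)
∣p∣≡count []          = refl
∣p∣≡count (true ∷ p)  = cong suc (∣p∣≡count p)
∣p∣≡count (false ∷ p) = ∣p∣≡count p

0<count⇒∃true : ∀ {n} (P : Fin n → Bool) → 0 < count P → ∃[ i ] P i ≡ true
0<count⇒∃true {suc n} P 0<c with P zero in P0
... | true  = zero , P0
... | false with 0<count⇒∃true (P ∘ suc) 0<c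
...   | i , Pi = suc i , Pi

count<n⇒∃false : ∀ {n} (P : Fin n → Bool) → count P < n → ∃[ i ] P i ≡ false
count<n⇒∃false {suc n} P c<n with P zero in P0
... | false = zero , P0
... | true with count<n⇒∃false (P ∘ suc) (s≤s⁻¹ c<n)
...   | i , Pi = suc i , Pi

sameCount⇒∃match : ∀ {n} (P Q : Fin (suc n) → Bool) → count P ≡ count Q → ∃[ j ] Q j ≡ P zero
sameCount⇒∃match P Q P≡Q with P zero
... | true  = 0<count⇒∃true Q (subst (0 <_) P≡Q (s≤s z≤n))
... | false = count<n⇒∃false Q (subst (_< _) P≡Q (s≤s (count≤n (P ∘ suc))))

sameCount⇒∃permutation : ∀ {n} (P Q : Fin n → Bool) → count P ≡ count Q →
  Σ (Permutation′ n) λ π → ∀ i → Q (π ⟨$⟩ʳ i) ≡ P i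
sameCount⇒∃permutation {zero}  P Q _ = Permutation.id , λ ()
sameCount⇒∃permutation {suc n} P Q P≡Q = lift₀ (Σ.proj₁ rec) ∘ₚ τ , matches
  where
  match : ∃[ j ] Q j ≡ P zero
  match = sameCount⇒∃match P Q P≡Q
  τ : Permutation′ (suc n)
  τ = transpose zero (Σ.proj₁ match)
  Q′ : Fin (suc n) → Bool
  Q′ = Q ∘ (τ ⟨$⟩ʳ_)
  tails : count (P ∘ suc) ≡ count (Q′ ∘ suc)
  tails = +-cancelˡ-≡ (if P zero then 1 else 0) _ _ (begin
    count P            ≡⟨ P≡Q ⟩
    count Q            ≡⟨ ≡.sym (count-permute Q τ) ⟩
    count Q′           ≡⟨ cong (λ b → (if b then 1 else 0) + count (Q′ ∘ suc)) (Σ.proj₂ match) ⟩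
    (if P zero then 1 else 0) + count (Q′ ∘ suc) ∎)
    where open ≡-Reasoning
  rec : Σ (Permutation′ n) λ π → ∀ i → Q′ (suc (π ⟨$⟩ʳ i)) ≡ P (suc i)
  rec = sameCount⇒∃permutation (P ∘ suc) (Q′ ∘ suc) tails
  matches : ∀ i → Q′ (lift₀ (Σ.proj₁ rec) ⟨$⟩ʳ i) ≡ P i
  matches zero    = Σ.proj₂ match
  matches (suc i) = Σ.proj₂ rec i

evenLabel : ∀ {n} → Fin n → Bool
evenLabel i = isEven (suc (toℕ i))

count-isEven : ∀ n → count {n} (isEven ∘ toℕ) ≡ ⌈ n /2⌉
count-evenLabel : ∀ n → count {n} evenLabel ≡ ⌊ n /2⌋
count-isEven zero        = refl
count-isEven (suc n)     = cong suc (count-evenLabel n)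
count-evenLabel zero    = refl
count-evenLabel (suc n) =
  trans (count-cong {n} (λ i → not-involutive (isEven (toℕ i)))) (count-isEven n)

n/2≡⌊n/2⌋ : ∀ n → n / 2 ≡ ⌊ n /2⌋
n/2≡⌊n/2⌋ zero          = refl
n/2≡⌊n/2⌋ (suc zero)    = refl
n/2≡⌊n/2⌋ (suc (suc n)) = trans (m/n≡1+[m∸n]/n {suc (suc n)} {2} (s≤s (s≤s z≤n))) (cong suc (n/2≡⌊n/2⌋ n))

flipIf : Bool → Sign → Sign
flipIf b s = if b then neg s else s

flipIf-flipIf : ∀ a b s → flipIf a (flipIf b s) ≡ flipIf (a xor b) s
flipIf-flipIf false b     s     = refl
flipIf-flipIf true  true  plus  = refl
flipIf-flipIf true  true  minus = refl
flipIf-flipIf true  false s     = refl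

incident≡xor : ∀ {n} {u v : Fin n} → u ≢ v → ∀ x → incident x u v ≡ does (x ≟ u) xor does (x ≟ v)
incident≡xor {u = u} {v} u≢v x with x ≟ u | x ≟ v
... | yes refl | yes refl = ⊥-elim (u≢v refl)
... | yes _    | no _     = refl
... | no _     | yes _    = refl
... | no _     | no _     = refl

xorSum-select : ∀ {n} (g : Fin n → Bool) (u : Fin n) → Xor-Sum.sum (λ x → g x ∧ does (x ≟ u)) ≡ g u
xorSum-select {suc n} g zero = begin
  g zero ∧ true xor Xor-Sum.sum (λ x → g (suc x) ∧ false)
    ≡⟨ cong₂ _xor_ (∧-identityʳ (g zero)) (Xor-Sum.sum-cong-≗ {n} (∧-zeroʳ ∘ g ∘ suc)) ⟩
  g zero xor Xor-Sum.sum {n} (λ _ → false)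
    ≡⟨ cong (g zero xor_) (Xor-Sum.sum-replicate-zero n) ⟩
  g zero xor false
    ≡⟨ xor-identityʳ (g zero) ⟩
  g zero ∎
  where open ≡-Reasoning
xorSum-select {suc n} g (suc u) =
  cong₂ _xor_ (∧-zeroʳ (g zero)) (xorSum-select (g ∘ suc) u)

module _ {n} (S : Subset n) (s : Fin n → Fin n → Sign) {u v : Fin n} where

  switchesUV : Fin n → Bool
  switchesUV x = lookup S x ∧ incident x u v

  foldr-switch : ∀ {m} (h : Fin m → Fin n) →
    foldr (λ x t → if lookup S x then switchAt x t else t) s (List.tabulate h) u v
      ≡ flipIf (Xor-Sum.sum (switchesUV ∘ h)) (s u v)
  foldr-switch {zero}  h = refl
  foldr-switch {suc m} h = begin
    (if lookup S (h zero) then switchAt (h zero) t else t) u v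
      ≡⟨ switchIf-edge (lookup S (h zero)) (h zero) t ⟩
    flipIf (switchesUV (h zero)) (t u v)
      ≡⟨ cong (flipIf (switchesUV (h zero))) (foldr-switch (h ∘ suc)) ⟩
    flipIf (switchesUV (h zero)) (flipIf (Xor-Sum.sum (switchesUV ∘ h ∘ suc)) (s u v))
      ≡⟨ flipIf-flipIf (switchesUV (h zero)) _ (s u v) ⟩
    flipIf (Xor-Sum.sum (switchesUV ∘ h)) (s u v) ∎
    where
    open ≡-Reasoning
    t : Fin n → Fin n → Sign
    t = foldr (λ x t → if lookup S x then switchAt x t else t) s (List.tabulate (h ∘ suc))
    switchIf-edge : ∀ b x (t : Fin n → Fin n → Sign) →
      (if b then switchAt x t else t) u v ≡ flipIf (b ∧ incident x u v) (t u v)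
    switchIf-edge true  x t = refl
    switchIf-edge false x t = refl

  switchSet-edge : u ≢ v → switchSet S s u v ≡ flipIf (lookup S u xor lookup S v) (s u v)
  -- allFin n is List.tabulate id, hence the generality of foldr-switch.
  switchSet-edge u≢v = trans (foldr-switch (λ x → x)) (cong (λ b → flipIf b (s u v)) (begin
    Xor-Sum.sum switchesUV
      ≡⟨ Xor-Sum.sum-cong-≗ (λ x → trans (cong (lookup S x ∧_) (incident≡xor u≢v x))
                                         (∧-distribˡ-xor (lookup S x) _ _)) ⟩
    Xor-Sum.sum (λ x → (lookup S x ∧ does (x ≟ u)) xor (lookup S x ∧ does (x ≟ v)))
      ≡⟨ Xor-Sum.∑-distrib-+ (λ x → lookup S x ∧ does (x ≟ u)) (λ x → lookup S x ∧ does (x ≟ v)) ⟩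
    Xor-Sum.sum (λ x → lookup S x ∧ does (x ≟ u)) xor Xor-Sum.sum (λ x → lookup S x ∧ does (x ≟ v))
      ≡⟨ cong₂ _xor_ (xorSum-select (lookup S) u) (xorSum-select (lookup S) v) ⟩
    lookup S u xor lookup S v ∎))
    where open ≡-Reasoning

evenLabelled : ∀ {n} → (Fin n → Fin n) → Subset n
evenLabelled f = tabulate (evenLabel ∘ f)

∣evenLabelled∣ : ∀ {n} {f : Fin n → Fin n} → Bijective _≡_ _≡_ f → ∣ evenLabelled f ∣ ≡ n / 2
∣evenLabelled∣ {n} {f} f-bij = begin
  ∣ evenLabelled f ∣                  ≡⟨ ∣p∣≡count (evenLabelled f) ⟩
  count (lookup (evenLabelled f))     ≡⟨ count-cong (lookup∘tabulate (evenLabel ∘ f)) ⟩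
  count (evenLabel ∘ f)               ≡⟨ count-permute evenLabel (⤖⇒↔ (mk⤖ f-bij)) ⟩
  count {n} evenLabel                 ≡⟨ count-evenLabel n ⟩
  ⌊ n /2⌋                             ≡⟨ ≡.sym (n/2≡⌊n/2⌋ n) ⟩
  n / 2                               ∎
  where open ≡-Reasoning

∣p∣≡n/2⇒evenLabelled : ∀ {n} (p : Subset n) → ∣ p ∣ ≡ n / 2 →
  Σ (Permutation′ n) λ π → p ≡ evenLabelled (π ⟨$⟩ʳ_)
∣p∣≡n/2⇒evenLabelled {n} p ∣p∣≡n/2
  with sameCount⇒∃permutation (lookup p) evenLabel sameCount
  where
  sameCount : count (lookup p) ≡ count {n} evenLabel
  sameCount = begin
    count (lookup p)     ≡⟨ ≡.sym (∣p∣≡count p) ⟩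
    ∣ p ∣                ≡⟨ ∣p∣≡n/2 ⟩
    n / 2                ≡⟨ n/2≡⌊n/2⌋ n ⟩
    ⌊ n /2⌋              ≡⟨ ≡.sym (count-evenLabel n) ⟩
    count {n} evenLabel  ∎
    where open ≡-Reasoning
... | π , π-matches = π , (begin
  p                              ≡⟨ ≡.sym (tabulate∘lookup p) ⟩
  tabulate (lookup p)            ≡⟨ tabulate-cong (≡.sym ∘ π-matches) ⟩
  evenLabelled (π ⟨$⟩ʳ_)         ∎)
  where open ≡-Reasoning

paritySign : ℕ → ℕ → Sign
paritySign a b = if sameParity a b then plus else minus

paritySign≡flipIf : ∀ a b → paritySign a b ≡ flipIf (isEven a xor isEven b) plus
paritySign≡flipIf a b with isEven a | isEven b
... | true  | true  = refl
... | true  | false = refl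
... | false | true  = refl
... | false | false = refl

adj⇒≢ : ∀ {n} (G : SimpleGraph n) {u v} → Adj G u v → u ≢ v
adj⇒≢ G {u} uv refl = subst T (irref G u) uv

switching-evenLabelled : ∀ {n} (G : SimpleGraph n) (f : Fin n → Fin n) {u v} → Adj G u v →
  sign (switching (evenLabelled f) (allPlus G)) u v ≡ paritySign (suc (toℕ (f u))) (suc (toℕ (f v)))
switching-evenLabelled G f {u} {v} uv = begin
  switchSet (evenLabelled f) (λ _ _ → plus) u v
    ≡⟨ switchSet-edge (evenLabelled f) (λ _ _ → plus) (adj⇒≢ G uv) ⟩
  flipIf (lookup (evenLabelled f) u xor lookup (evenLabelled f) v) plus
    ≡⟨ cong₂ (λ a b → flipIf (a xor b) plus)
             (lookup∘tabulate (evenLabel ∘ f) u) (lookup∘tabulate (evenLabel ∘ f) v) ⟩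
  flipIf (evenLabel (f u) xor evenLabel (f v)) plus
    ≡⟨ ≡.sym (paritySign≡flipIf (suc (toℕ (f u))) (suc (toℕ (f v)))) ⟩
  paritySign (suc (toℕ (f u))) (suc (toℕ (f v))) ∎
  where open ≡-Reasoning

parityLabelling⇔switching : ∀ {n} {G : SimpleGraph n} (σ : Signature G) (f : Fin n → Fin n) →
  ParityLabelling σ f ⇔ σ ≈E switching (evenLabelled f) (allPlus G)
parityLabelling⇔switching {G = G} σ f = mk⇔
  (λ parity u v uv → trans (parity u v uv) (≡.sym (switching-evenLabelled G f uv)))
  (λ σ≈ u v uv → trans (σ≈ u v uv) (switching-evenLabelled G f uv))

proposition1 : (n : ℕ) (G : SimpleGraph n) → Connected G → (σ : Signature G) →
    (Σ (Fin n → Fin n) (λ f → Bijective _≡_ _≡_ f × ParityLabelling σ f))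
      ⇔ (Σ (Subset n) (λ S → (∣ S ∣ ≡ n / 2) × (σ ≈E switching S (allPlus G))))
proposition1 n G _ σ = mk⇔ parity⇒switching switching⇒parity
  where
  parity⇒switching : Σ (Fin n → Fin n) (λ f → Bijective _≡_ _≡_ f × ParityLabelling σ f) →
    Σ (Subset n) (λ S → (∣ S ∣ ≡ n / 2) × (σ ≈E switching S (allPlus G)))
  parity⇒switching (f , f-bij , parity) =
    evenLabelled f , ∣evenLabelled∣ f-bij , Equivalence.to (parityLabelling⇔switching σ f) parity

  switching⇒parity : Σ (Subset n) (λ S → (∣ S ∣ ≡ n / 2) × (σ ≈E switching S (allPlus G))) →
    Σ (Fin n → Fin n) (λ f → Bijective _≡_ _≡_ f × ParityLabelling σ f)
  switching⇒parity (S , ∣S∣≡n/2 , σ≈) with ∣p∣≡n/2⇒evenLabelled S ∣S∣≡n/2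
  ... | π , refl =
    (π ⟨$⟩ʳ_) , Bijection.bijective (Inverse⇒Bijection π) ,
    Equivalence.from (parityLabelling⇔switching σ (π ⟨$⟩ʳ_)) σ≈
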